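{- Let $k_A,k_B,\ell,k_1,k_2$ be integers such that $k_A,k_B\ge 2$ and $\ell=k_1+k_2+1$. Then the complete bipartite graph $G=(A\cup B,E)$ with $|A|=\overline{M}(k_1,k_A,\ell)$ and $|B|=\overline{M}(k_2,k_B,\ell)$ is not $(k_A,k_B)$-choosable.
   Context: For positive integers $k_1,k_2,\ell$, a family $\mathcal F$ of $k_2$-element subsets of $[\ell]=\{1,\dots,\ell\}$ has Property A$(k_1,k_2,\ell)$ if there is a $k_1$-element subset of $[\ell]$ that intersects every set in $\mathcal F$. $\overline{M}(k_1,k_2,\ell)$ denotes the minimum cardinality of a family of $k_2$-element subsets of $[\ell]$ that does not have Property A$(k_1,k_2,\ell)$ (equivalently, the minimum number of edges of a $k_2$-uniform hypergraph on $\ell$ vertices with no independent set of size $\ell-k_1$). For a bipartite graph $G=(A\cup B,E)$ with designated parts $A,B$, a $(k_A,k_B)$-list-assignment assigns to each vertex of $A$ a set of $k_A$ positive integers and to each vertex of $B$ a set of $k_B$ positive integers; $G$ is $(k_A,k_B)$-choosable if for every such assignment $L$ there is a proper colouring $c$ with $c(v)\in L(v)$ for all $v$. -}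

module Defs where

open import Data.Nat using (ℕ; _≤_; _<_)
open import Data.Fin using (Fin)
open import Data.Fin.Subset using (Subset; ∣_∣; _∩_; Nonempty)
open import Data.List using (List; length)
open import Data.List.Relation.Unary.All using (All)
open import Data.List.Relation.Unary.Unique.Propositional using (Unique)
open import Data.List.Membership.Propositional using (_∈_)
open import Data.Product using (Σ; _×_; ∃)
open import Relation.Binary.PropositionalEquality using (_≡_; _≢_)
open import Relation.Nullary using (¬_)
open import Function.Definitions using (Injective)
open import Level using (0ℓ)

IsFamily : (k ℓ m : ℕ) → (Fin m → Subset ℓ) → Set
IsFamily k ℓ m F = Injective _≡_ _≡_ F × (∀ i → ∣ F i ∣ ≡ k)

PropertyA : (k₁ ℓ m : ℕ) → (Fin m → Subset ℓ) → Set
PropertyA k₁ ℓ m F = Σ (Subset ℓ) λ S → (∣ S ∣ ≡ k₁) × (∀ i → Nonempty (S ∩ F i))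

IsMbar : (k₁ k₂ ℓ m : ℕ) → Set
IsMbar k₁ k₂ ℓ m =
  (Σ (Fin m → Subset ℓ) λ F → IsFamily k₂ ℓ m F × ¬ PropertyA k₁ ℓ m F)
  × (∀ n (F : Fin n → Subset ℓ) → IsFamily k₂ ℓ n F → ¬ PropertyA k₁ ℓ n F → m ≤ n)

record BipartiteGraph : Set₁ where
  field
    a b : ℕ
    E   : Fin a → Fin b → Set

completeBipartite : ℕ → ℕ → BipartiteGraph
completeBipartite a b = record { a = a ; b = b ; E = λ _ _ → Data.Unit.⊤ }
  where import Data.Unit

IsKSetPos : ℕ → List ℕ → Set
IsKSetPos k xs = Unique xs × length xs ≡ k × All (λ x → 0 < x) xs
  where open import Data.Nat using (zero)

Choosable : BipartiteGraph → ℕ → ℕ → Set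
Choosable G kA kB =
  (LA : Fin a → List ℕ) (LB : Fin b → List ℕ) →
  (∀ i → IsKSetPos kA (LA i)) → (∀ j → IsKSetPos kB (LB j)) →
  Σ (Fin a → ℕ) λ cA → Σ (Fin b → ℕ) λ cB →
    (∀ i → cA i ∈ LA i) × (∀ j → cB j ∈ LB j) ×
    (∀ i j → E i j → cA i ≢ cB j)
  where open BipartiteGraph G

-- Take families F_A, F_B witnessing M̄ (they lack Property A) and
-- give vertex i of A the list F_A(i) and vertex j of B the list F_B(j), the
-- elements of [ℓ] being encoded as the colours 1,…,ℓ.  A proper colouring
-- picks from every F_A(i) an element x_A(i); the set T_A of picked elements
-- meets every member of F_A, so |T_A| > k₁ (otherwise T_A enlarges to a
-- k₁-element set meeting all of F_A, i.e. Property A).  Likewise |T_B| > k₂.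
-- The graph is complete bipartite, so T_A and T_B are disjoint subsets of
-- [ℓ], whence k₁ + k₂ + 2 ≤ |T_A| + |T_B| ≤ ℓ = k₁ + k₂ + 1: a contradiction.

module Submission where

open import Defs
open import Data.Nat using (ℕ; _≤_; _+_)
open import Relation.Binary.PropositionalEquality using (_≡_)
open import Relation.Nullary using (¬_)

open import Data.Nat using (zero; suc; _<_; _∸_; z≤n; s≤s; s≤s⁻¹; _≤?_; _≟_)
open import Data.Nat.Properties
  using ( suc-injective; n≤0⇒n≡0; ≤∧≢⇒<; ≰⇒>; ≤-trans; m≤m+n; m≤n+m
        ; ≤-reflexive; +-monoʳ-≤; +-mono-≤; m+[n∸m]≡n; +-suc; +-comm; 1+n≰n )
open import Data.Bool using (Bool; true; false)
open import Data.Fin using (Fin; toℕ) renaming (zero to fzero; suc to fsuc)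
open import Data.Fin.Subset using (Subset; ∣_∣; _∪_; ⁅_⁆; ⊥; ∁; _⊆_)
  renaming (_∈_ to _∈ₛ_)
open import Data.Fin.Subset.Properties
  using ( x∈⁅x⁆; x∈⁅y⁆⇒x≡y; x∈p∪q⁺; x∈p∪q⁻; x∈p∩q⁺; ∉⊥
        ; x∉p⇒x∈∁p; p⊆q⇒∣p∣≤∣q∣; ∣∁p∣≡n∸∣p∣; ∣p∣≤n )
open import Data.Vec using (_∷_; []; here; there)
open import Data.List using (List; map; length) renaming (_∷_ to _∷ₗ_; [] to []ₗ)
open import Data.List.Properties using (length-map)
open import Data.List.Relation.Unary.All as All using (All)
import Data.List.Relation.Unary.All.Properties as AllP
open import Data.List.Relation.Unary.AllPairs using (AllPairs)
open import Data.List.Relation.Unary.Unique.Propositional using (Unique)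
import Data.List.Relation.Unary.Unique.Propositional.Properties as UniqueP
open import Data.List.Relation.Unary.Any using () renaming (here to hereₗ; there to thereₗ)
open import Data.List.Membership.Propositional using (_∈_)
open import Data.List.Membership.Propositional.Properties using (∈-map⁻)
open import Data.Product using (Σ; _×_; _,_; proj₁; proj₂)
open import Data.Sum using (inj₁; inj₂)
open import Data.Empty using (⊥-elim) renaming (⊥ to Empty)
open import Relation.Binary.PropositionalEquality using (refl; sym; trans; cong; subst)
open import Relation.Nullary using (yes; no)

private
  variable
    m n k : ℕ

-- Colours are positive integers; the element x of [n] receives colour x + 1.
colourOf : Fin n → ℕ
colourOf x = suc (toℕ x)

colourList : Subset n → List ℕ
colourList []          = []ₗ
colourList (true ∷ p)  = 1 ∷ₗ map suc (colourList p)
colourList (false ∷ p) = map suc (colourList p)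

colourList-positive : (p : Subset n) → All (0 <_) (colourList p)
colourList-positive []          = All.[]
colourList-positive (true ∷ p)  = s≤s z≤n All.∷ AllP.map⁺ (All.universal (λ _ → s≤s z≤n) _)
colourList-positive (false ∷ p) = AllP.map⁺ (All.universal (λ _ → s≤s z≤n) _)

colourList-length : (p : Subset n) → length (colourList p) ≡ ∣ p ∣
colourList-length []          = refl
colourList-length (true ∷ p)  = cong suc (trans (length-map suc (colourList p)) (colourList-length p))
colourList-length (false ∷ p) = trans (length-map suc (colourList p)) (colourList-length p)

-- Distinct elements get distinct colours; the head colour 1 differs from the
-- shifted tail because the tail colours are already positive.
colourList-unique : (p : Subset n) → Unique (colourList p)
colourList-unique []          = AllPairs.[]
colourList-unique (true ∷ p)  =
  AllP.map⁺ (All.map (λ { (s≤s z≤n) () }) (colourList-positive p))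
    AllPairs.∷ UniqueP.map⁺ suc-injective (colourList-unique p)
colourList-unique (false ∷ p) = UniqueP.map⁺ suc-injective (colourList-unique p)

colourList-isKSet : (p : Subset n) → ∣ p ∣ ≡ k → IsKSetPos k (colourList p)
colourList-isKSet p ∣p∣≡k =
  colourList-unique p , trans (colourList-length p) ∣p∣≡k , colourList-positive p

colourList-member-shifted : (p : Subset n) {b : Bool} {c : ℕ} → c ∈ map suc (colourList p) →
                            Σ (Fin (suc n)) λ x → x ∈ₛ (b ∷ p) × c ≡ colourOf x

colourList-member : (p : Subset n) {c : ℕ} → c ∈ colourList p →
                    Σ (Fin n) λ x → x ∈ₛ p × c ≡ colourOf x
colourList-member []          ()
colourList-member (true ∷ p)  (hereₗ refl) = fzero , here , refl
colourList-member (true ∷ p)  (thereₗ c∈) = colourList-member-shifted p c∈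
colourList-member (false ∷ p) c∈          = colourList-member-shifted p c∈

colourList-member-shifted p c∈ with ∈-map⁻ suc c∈
... | _ , c′∈ , refl with colourList-member p c′∈
...   | x , x∈p , refl = fsuc x , there x∈p , refl

elementsOfColours : (F : Fin m → Subset n) (c : Fin m → ℕ) →
                    (∀ i → c i ∈ colourList (F i)) →
                    Σ (Fin m → Fin n) λ x → (∀ i → x i ∈ₛ F i) × (∀ i → c i ≡ colourOf (x i))
elementsOfColours F c c∈ =
  (λ i → proj₁ (member i)) , (λ i → proj₁ (proj₂ (member i))) , (λ i → proj₂ (proj₂ (member i)))
  where member = λ i → colourList-member (F i) (c∈ i)

image : (Fin m → Fin n) → Subset n
image {zero}  f = ⊥
image {suc m} f = ⁅ f fzero ⁆ ∪ image (λ i → f (fsuc i))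

image-∋ : (f : Fin m → Fin n) (i : Fin m) → f i ∈ₛ image f
image-∋ f fzero    = x∈p∪q⁺ (inj₁ (x∈⁅x⁆ (f fzero)))
image-∋ f (fsuc i) = x∈p∪q⁺ (inj₂ (image-∋ (λ i → f (fsuc i)) i))

image-∈ : (f : Fin m → Fin n) {y : Fin n} → y ∈ₛ image f → Σ (Fin m) λ i → f i ≡ y
image-∈ {zero}  f y∈ = ⊥-elim (∉⊥ y∈)
image-∈ {suc m} f y∈ with x∈p∪q⁻ ⁅ f fzero ⁆ (image (λ i → f (fsuc i))) y∈
... | inj₁ y∈head = fzero , sym (x∈⁅y⁆⇒x≡y (f fzero) y∈head)
... | inj₂ y∈tail with image-∈ (λ i → f (fsuc i)) y∈tail
...   | i , fi≡y = fsuc i , fi≡y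

enlarge : (S : Subset n) (k : ℕ) → ∣ S ∣ ≤ k → k ≤ n → Σ (Subset n) λ T → S ⊆ T × ∣ T ∣ ≡ k
enlarge []          zero    _ _ = [] , (λ x∈ → x∈) , refl
enlarge (true ∷ S)  (suc k) (s≤s ∣S∣≤k) (s≤s k≤n) with enlarge S k ∣S∣≤k k≤n
... | T , S⊆T , ∣T∣≡k = true ∷ T , (λ { here → here ; (there x∈) → there (S⊆T x∈) }) , cong suc ∣T∣≡k
enlarge (false ∷ S) k ∣S∣≤k k≤n with ∣ S ∣ ≟ k
... | yes ∣S∣≡k = false ∷ S , (λ x∈ → x∈) , ∣S∣≡k
enlarge (false ∷ S) zero    ∣S∣≤0 _ | no ∣S∣≢0 = ⊥-elim (∣S∣≢0 (n≤0⇒n≡0 ∣S∣≤0))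
enlarge (false ∷ S) (suc k) ∣S∣≤k (s≤s k≤n) | no ∣S∣≢k
  with enlarge S k (s≤s⁻¹ (≤∧≢⇒< ∣S∣≤k ∣S∣≢k)) k≤n
... | T , S⊆T , ∣T∣≡k = true ∷ T , (λ { (there x∈) → there (S⊆T x∈) }) , cong suc ∣T∣≡k

disjoint-sizes : (p q : Subset n) → (∀ {x} → x ∈ₛ p → x ∈ₛ q → Empty) →
                 ∣ p ∣ + ∣ q ∣ ≤ n
disjoint-sizes {n} p q disjoint = ≤-trans (+-monoʳ-≤ ∣ p ∣ ∣q∣≤n∸∣p∣) (≤-reflexive (m+[n∸m]≡n (∣p∣≤n p)))
  where
  q⊆∁p : q ⊆ ∁ p
  q⊆∁p x∈q = x∉p⇒x∈∁p (λ x∈p → disjoint x∈p x∈q)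
  ∣q∣≤n∸∣p∣ : ∣ q ∣ ≤ n ∸ ∣ p ∣
  ∣q∣≤n∸∣p∣ = subst (∣ q ∣ ≤_) (∣∁p∣≡n∸∣p∣ p) (p⊆q⇒∣p∣≤∣q∣ q⊆∁p)

transversal-large : (F : Fin m → Subset n) → ¬ PropertyA k n m F → k ≤ n →
                    (x : Fin m → Fin n) → (∀ i → x i ∈ₛ F i) → k < ∣ image x ∣
transversal-large {k = k} F noA k≤n x x∈F with ∣ image x ∣ ≤? k
... | no ∣T∣≰k = ≰⇒> ∣T∣≰k
... | yes ∣T∣≤k with enlarge (image x) k ∣T∣≤k k≤n
...   | S , T⊆S , ∣S∣≡k = ⊥-elim (noA (S , ∣S∣≡k , λ i → x i , x∈p∩q⁺ (T⊆S (image-∋ x i) , x∈F i)))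

too-many : ∀ a b → ¬ (suc a + suc b ≤ a + b + 1)
too-many a b h rewrite +-suc a b | +-comm (a + b) 1 = 1+n≰n h

theorem1p6 : (kA kB k₁ k₂ ℓ : ℕ) → 2 ≤ kA → 2 ≤ kB → 1 ≤ k₁ → 1 ≤ k₂ →
    ℓ ≡ k₁ + k₂ + 1 →
    (mA mB : ℕ) → IsMbar k₁ kA ℓ mA → IsMbar k₂ kB ℓ mB →
    ¬ Choosable (completeBipartite mA mB) kA kB
theorem1p6 kA kB k₁ k₂ _ _ _ _ _ refl mA mB
           ((FA , (_ , ∣FA∣≡kA) , noA) , _) ((FB , (_ , ∣FB∣≡kB) , noB) , _) choosable
  with choosable (λ i → colourList (FA i)) (λ j → colourList (FB j))
                 (λ i → colourList-isKSet (FA i) (∣FA∣≡kA i))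
                 (λ j → colourList-isKSet (FB j) (∣FB∣≡kB j))
... | cA , cB , cA∈ , cB∈ , proper
  with elementsOfColours FA cA cA∈ | elementsOfColours FB cB cB∈
...   | xA , xA∈ , cA≡ | xB , xB∈ , cB≡ =
  too-many k₁ k₂ (≤-trans (+-mono-≤ largeA largeB) (disjoint-sizes (image xA) (image xB) disjoint))
  where
  largeA : k₁ < ∣ image xA ∣
  largeA = transversal-large FA noA (≤-trans (m≤m+n k₁ k₂) (m≤m+n _ 1)) xA xA∈
  largeB : k₂ < ∣ image xB ∣
  largeB = transversal-large FB noB (≤-trans (m≤n+m k₂ k₁) (m≤m+n _ 1)) xB xB∈
  -- An element picked on both sides would give adjacent vertices equal colours.
  disjoint : ∀ {y} → y ∈ₛ image xA → y ∈ₛ image xB → Empty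
  disjoint yA yB with image-∈ xA yA | image-∈ xB yB
  ... | i , refl | j , xBj≡xAi = proper i j _ (trans (cA≡ i) (trans (cong colourOf (sym xBj≡xAi)) (sym (cB≡ j))))
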